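{- Let $\mathbb{P}$ be a finite projective plane of odd order $p$, and consider the switching game on $\mathbb{P}$. Then any configuration with an even number of lit bulbs can be transformed by switch flips into a configuration with $0$ lit bulbs, and any configuration with an odd number of lit bulbs can be transformed by switch flips into a configuration with exactly $1$ lit bulb. In particular, the maximum number of lit bulbs in an irreducible configuration (the worst case) is $1$.
   Context: A finite projective plane of order $p$ has $p^2+p+1$ points and $p^2+p+1$ lines, each line contains $p+1$ points, each point lies on $p+1$ lines, and any two points lie on exactly one line. The switching game: there is one light bulb at each point, each either on (lit) or off; there is one switch for each line, and flipping the switch of a line toggles the state of every bulb at a point of that line. A configuration is an assignment of on/off states to all bulbs. A configuration is reducible if some finite sequence of switch flips produces a configuration with strictly fewer lit bulbs than the initial one; otherwise it is irreducible. -}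

module Defs where

open import Data.Nat using (ℕ; zero; suc; _+_; _*_; _<_)
open import Data.Bool using (Bool; true; false; _xor_; if_then_else_)
open import Data.Fin using (Fin; zero; suc)
open import Data.List using (List; foldr)
open import Data.Product using (Σ; _×_; ∃)
open import Relation.Binary.PropositionalEquality using (_≡_; _≢_)
open import Relation.Nullary using (¬_)
open import Data.Nat.Divisibility using (_∣_)

Even : ℕ → Set
Even n = 2 ∣ n

Odd : ℕ → Set
Odd n = ¬ (2 ∣ n)

count : ∀ {n} → (Fin n → Bool) → ℕ
count {zero}  f = 0
count {suc n} f = (if f zero then 1 else 0) + count {n} (λ i → f (suc i))

size : ℕ → ℕ
size p = p * p + p + 1

-- A finite projective plane of order p: points and lines are both Fin (p²+p+1),
-- incidence given by a Boolean relation  on x l  ("point x lies on line l").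
record ProjectivePlane (p : ℕ) : Set where
  field
    on        : Fin (size p) → Fin (size p) → Bool
    linePts   : ∀ l → count (λ x → on x l) ≡ suc p
    ptLines   : ∀ x → count (λ l → on x l) ≡ suc p
    joinExist : ∀ x y → x ≢ y → Σ (Fin (size p)) λ l → (on x l ≡ true) × (on y l ≡ true)
    joinUniq  : ∀ x y → x ≢ y → ∀ l m →
                on x l ≡ true → on y l ≡ true → on x m ≡ true → on y m ≡ true → l ≡ m

module Game {p : ℕ} (P : ProjectivePlane p) where
  open ProjectivePlane P

  Config : Set
  Config = Fin (size p) → Bool   -- true = lit

  lit : Config → ℕ
  lit c = count c

  flip : Fin (size p) → Config → Config
  flip l c x = c x xor on x l

  flips : List (Fin (size p)) → Config → Config
  flips ls c = foldr flip c ls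

  Reducible : Config → Set
  Reducible c = Σ (List (Fin (size p))) λ ls → lit (flips ls c) < lit c

  Irreducible : Config → Set
  Irreducible c = ¬ Reducible c

module Submission where

-- For odd p every line has an even number p + 1 of points, so each switch preserves the
-- parity of the number of lit bulbs. Conversely, flipping all p + 1 lines through a point x
-- toggles x an even number of times and every other point exactly once (two points span a
-- unique line). Doing this for two points x and y therefore toggles exactly x and y, so two
-- lit bulbs can always be switched off together.

open import Defs
open import Algebra.Properties.CommutativeSemigroup using (interchange)
open import Data.Bool using (Bool; true; false; _xor_; not; _∧_; if_then_else_)
open import Data.Bool.Properties
  using (xor-assoc; xor-comm; xor-identityʳ; xor-annihilates-not; ∧-idem)
open import Data.Empty using (⊥-elim)
open import Data.Fin using (Fin; zero; suc; _≟_; fromℕ<)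
open import Data.List using (List; []; _∷_; _++_; map; foldr)
open import Data.List.Properties using (map-∘; foldr-++)
open import Data.Nat using (ℕ; zero; suc; _+_; _*_; _≤_; _<_; z≤n; s≤s; parity)
open import Data.Nat.Divisibility using (_∣_; divides; ∣m∣n⇒∣m+n; ∣-refl)
open import Data.Nat.Properties using (+-suc; suc-injective; m≤n+m; n≤1+n; n<1⇒n≡0)
open import Data.Parity.Base as ℙ using (Parity; 0ℙ; 1ℙ; _⁻¹)
open import Data.Parity.Properties as ℙ using (+-homo-+; *-homo-*)
open import Data.Product using (Σ; ∃; _×_; _,_)
open import Data.Sum using (_⊎_; inj₁; inj₂)
open import Function using (_∘_)
open import Relation.Nullary using (does; yes; no; contradiction)
open import Relation.Binary.PropositionalEquality
open ≡-Reasoning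

even⇒parity≡0ℙ : ∀ {n} → 2 ∣ n → parity n ≡ 0ℙ
even⇒parity≡0ℙ (divides q refl) = trans (*-homo-* q 2) (ℙ.*-zeroʳ (parity q))

parity≡0ℙ⇒even : ∀ {n} → parity n ≡ 0ℙ → 2 ∣ n
parity≡0ℙ⇒even {zero}          _ = divides 0 refl
parity≡0ℙ⇒even {suc (suc n)} eq = ∣m∣n⇒∣m+n ∣-refl (parity≡0ℙ⇒even eq)

odd⇒parity≡1ℙ : ∀ {n} → Odd n → parity n ≡ 1ℙ
odd⇒parity≡1ℙ {n} odd with parity n in eq
... | 0ℙ = ⊥-elim (odd (parity≡0ℙ⇒even eq))
... | 1ℙ = refl

bit : Bool → Parity
bit false = 0ℙ
bit true  = 1ℙ

bit-xor : ∀ a b → bit (a xor b) ≡ bit a ℙ.+ bit b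
bit-xor false b     = refl
bit-xor true  false = refl
bit-xor true  true  = refl

bit-injective : ∀ {a b} → bit a ≡ bit b → a ≡ b
bit-injective {false} {false} _ = refl
bit-injective {true}  {true}  _ = refl

xorAll : List Bool → Bool
xorAll = foldr _xor_ false

module _ {n : ℕ} where

  infixl 6 _⊕_

  _⊕_ : (Fin n → Bool) → (Fin n → Bool) → Fin n → Bool
  (f ⊕ g) i = f i xor g i

  δ : Fin n → Fin n → Bool
  δ i j = does (i ≟ j)

  δ-diag : ∀ i → δ i i ≡ true
  δ-diag i with i ≟ i
  ... | yes _  = refl
  ... | no i≢i = ⊥-elim (i≢i refl)

count-ext : ∀ {n} {f g : Fin n → Bool} → (∀ i → f i ≡ g i) → count f ≡ count g
count-ext {zero}  eq = refl
count-ext {suc n} eq = cong₂ (λ b k → (if b then 1 else 0) + k) (eq zero) (count-ext (eq ∘ suc))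

count-false : ∀ {n} {f : Fin n → Bool} → (∀ i → f i ≡ false) → count f ≡ 0
count-false {zero}      _   = refl
count-false {suc n} {f} off rewrite off zero = count-false (off ∘ suc)

count-unlight : ∀ {n} (f : Fin n → Bool) {i} → f i ≡ true → count f ≡ suc (count (f ⊕ δ i))
count-unlight f {zero} fi rewrite fi = cong suc (count-ext (λ j → sym (xor-identityʳ (f (suc j)))))
count-unlight f {suc i} fi rewrite xor-identityʳ (f zero) | count-unlight (f ∘ suc) fi = +-suc _ _

count-one : ∀ {n} (f : Fin n → Bool) {i} → f i ≡ true → (∀ j → f j ≡ true → j ≡ i) → count f ≡ 1
count-one f {i} fi unique = trans (count-unlight f fi) (cong suc (count-false off))
  where
  off : ∀ j → (f ⊕ δ i) j ≡ false
  off j with i ≟ j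
  ... | yes refl rewrite fi = refl
  ... | no i≢j with f j in fj
  ...   | true  = ⊥-elim (i≢j (sym (unique j fj)))
  ...   | false = refl

count-δ : ∀ {n} (i : Fin n) → count (δ i) ≡ 1
count-δ i = count-one (δ i) (δ-diag i) unique
  where
  unique : ∀ j → δ i j ≡ true → j ≡ i
  unique j _  with i ≟ j
  unique j _  | yes i≡j = sym i≡j
  unique j () | no _

find-true : ∀ {n} (f : Fin n → Bool) {k} → count f ≡ suc k → ∃ λ i → f i ≡ true
find-true {suc n} f eq with f zero in f0
... | true  = zero , f0
... | false = let i , fi = find-true (f ∘ suc) eq in suc i , fi

parity-count-suc : ∀ {n} (f : Fin (suc n) → Bool) →
                   parity (count f) ≡ bit (f zero) ℙ.+ parity (count (f ∘ suc))
parity-count-suc f =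
  trans (+-homo-+ (if f zero then 1 else 0) _) (cong (ℙ._+ parity (count (f ∘ suc))) (parity-if (f zero)))
  where
  parity-if : ∀ b → parity (if b then 1 else 0) ≡ bit b
  parity-if false = refl
  parity-if true  = refl

parity-count-⊕ : ∀ {n} (f g : Fin n → Bool) →
                 parity (count (f ⊕ g)) ≡ parity (count f) ℙ.+ parity (count g)
parity-count-⊕ {zero}  f g = refl
parity-count-⊕ {suc n} f g = begin
  parity (count (f ⊕ g))
    ≡⟨ parity-count-suc (f ⊕ g) ⟩
  bit (f zero xor g zero) ℙ.+ parity (count ((f ∘ suc) ⊕ (g ∘ suc)))
    ≡⟨ cong₂ ℙ._+_ (bit-xor (f zero) (g zero)) (parity-count-⊕ (f ∘ suc) (g ∘ suc)) ⟩
  (bit (f zero) ℙ.+ bit (g zero)) ℙ.+ (parity (count (f ∘ suc)) ℙ.+ parity (count (g ∘ suc)))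
    ≡⟨ interchange ℙ.+-commutativeSemigroup (bit (f zero)) _ (parity (count (f ∘ suc))) _ ⟩
  (bit (f zero) ℙ.+ parity (count (f ∘ suc))) ℙ.+ (bit (g zero) ℙ.+ parity (count (g ∘ suc)))
    ≡⟨ sym (cong₂ ℙ._+_ (parity-count-suc f) (parity-count-suc g)) ⟩
  parity (count f) ℙ.+ parity (count g) ∎

support : ∀ {n} → (Fin n → Bool) → List (Fin n)
support {zero}  s = []
support {suc n} s = if s zero then zero ∷ map suc (support (s ∘ suc)) else map suc (support (s ∘ suc))

xorAll-support : ∀ {n} (s g : Fin n → Bool) →
                 bit (xorAll (map g (support s))) ≡ parity (count (λ i → s i ∧ g i))
xorAll-support {zero}  s g = refl
xorAll-support {suc n} s g = begin
  bit (xorAll (map g (support s)))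
    ≡⟨ cons-if (s zero) _ ⟩
  bit (s zero ∧ g zero) ℙ.+ bit (xorAll (map g (map suc (support (s ∘ suc)))))
    ≡⟨ cong (λ bs → bit (s zero ∧ g zero) ℙ.+ bit (xorAll bs)) (sym (map-∘ (support (s ∘ suc)))) ⟩
  bit (s zero ∧ g zero) ℙ.+ bit (xorAll (map (g ∘ suc) (support (s ∘ suc))))
    ≡⟨ cong (bit (s zero ∧ g zero) ℙ.+_) (xorAll-support (s ∘ suc) (g ∘ suc)) ⟩
  bit (s zero ∧ g zero) ℙ.+ parity (count (λ i → s (suc i) ∧ g (suc i)))
    ≡⟨ sym (parity-count-suc (λ i → s i ∧ g i)) ⟩
  parity (count (λ i → s i ∧ g i)) ∎
  where
  cons-if : ∀ b is → bit (xorAll (map g (if b then zero ∷ is else is)))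
                     ≡ bit (b ∧ g zero) ℙ.+ bit (xorAll (map g is))
  cons-if false is = refl
  cons-if true  is = bit-xor (g zero) _

module _ {p : ℕ} (P : ProjectivePlane p) where
  open ProjectivePlane P
  open Game P

  flips-pointwise : ∀ ls c z → flips ls c z ≡ c z xor xorAll (map (on z) ls)
  flips-pointwise []       c z = sym (xor-identityʳ (c z))
  flips-pointwise (l ∷ ls) c z = begin
    flips ls c z xor on z l                     ≡⟨ cong (_xor on z l) (flips-pointwise ls c z) ⟩
    (c z xor xorAll (map (on z) ls)) xor on z l ≡⟨ xor-assoc (c z) _ (on z l) ⟩
    c z xor (xorAll (map (on z) ls) xor on z l) ≡⟨ cong (c z xor_) (xor-comm _ (on z l)) ⟩
    c z xor (on z l xor xorAll (map (on z) ls)) ∎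

  linesThrough : Fin (size p) → List (Fin (size p))
  linesThrough x = support (on x)

  count-lines-through-both : ∀ {x z} → x ≢ z → count (λ l → on x l ∧ on z l) ≡ 1
  count-lines-through-both {x} {z} x≢z with joinExist x z x≢z
  ... | l , xl , zl = count-one _ (cong₂ _∧_ xl zl) unique
    where
    unique : ∀ m → on x m ∧ on z m ≡ true → m ≡ l
    unique m xzm with on x m in xm | on z m in zm
    unique m refl | true | true = joinUniq x z x≢z m l xm zm xl zl

  module _ (odd-p : Odd p) where

    parity-line : parity (suc p) ≡ 0ℙ
    parity-line = trans (+-homo-+ 1 p) (cong _⁻¹ (odd⇒parity≡1ℙ odd-p))

    parity-lit-flips : ∀ ls c → parity (lit (flips ls c)) ≡ parity (lit c)
    parity-lit-flips []       c = refl
    parity-lit-flips (l ∷ ls) c = begin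
      parity (count (flips ls c ⊕ (λ x → on x l)))
        ≡⟨ parity-count-⊕ (flips ls c) (λ x → on x l) ⟩
      parity (lit (flips ls c)) ℙ.+ parity (count (λ x → on x l))
        ≡⟨ cong₂ ℙ._+_ (parity-lit-flips ls c) (trans (cong parity (linePts l)) parity-line) ⟩
      parity (lit c) ℙ.+ 0ℙ
        ≡⟨ ℙ.+-identityʳ (parity (lit c)) ⟩
      parity (lit c) ∎

    flips-linesThrough : ∀ x c z → flips (linesThrough x) c z ≡ c z xor not (δ x z)
    flips-linesThrough x c z =
      trans (flips-pointwise (linesThrough x) c z) (cong (c z xor_) (bit-injective toggled))
      where
      toggled : bit (xorAll (map (on z) (linesThrough x))) ≡ bit (not (δ x z))
      toggled with x ≟ z
      ... | yes refl = begin
        bit (xorAll (map (on x) (linesThrough x))) ≡⟨ xorAll-support (on x) (on x) ⟩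
        parity (count (λ l → on x l ∧ on x l))     ≡⟨ cong parity (count-ext (λ l → ∧-idem (on x l))) ⟩
        parity (count (on x))                      ≡⟨ cong parity (ptLines x) ⟩
        parity (suc p)                             ≡⟨ parity-line ⟩
        0ℙ                                         ∎
      ... | no x≢z = trans (xorAll-support (on x) (on z))
                           (cong parity (count-lines-through-both x≢z))

    flips-linesThrough-pair : ∀ x y c z → flips (linesThrough y ++ linesThrough x) c z ≡ (c ⊕ δ x ⊕ δ y) z
    flips-linesThrough-pair x y c z = begin
      flips (linesThrough y ++ linesThrough x) c z
        ≡⟨ cong (λ c′ → c′ z) (foldr-++ flip c (linesThrough y) (linesThrough x)) ⟩
      flips (linesThrough y) (flips (linesThrough x) c) z
        ≡⟨ flips-linesThrough y _ z ⟩
      flips (linesThrough x) c z xor not (δ y z)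
        ≡⟨ cong (_xor not (δ y z)) (flips-linesThrough x c z) ⟩
      (c z xor not (δ x z)) xor not (δ y z)
        ≡⟨ xor-assoc (c z) _ _ ⟩
      c z xor (not (δ x z) xor not (δ y z))
        ≡⟨ cong (c z xor_) (xor-annihilates-not (δ x z) (δ y z)) ⟩
      c z xor (δ x z xor δ y z)
        ≡⟨ sym (xor-assoc (c z) _ _) ⟩
      (c ⊕ δ x ⊕ δ y) z ∎

    switch-off-two : ∀ c {k} → lit c ≡ suc (suc k) → Σ (List (Fin (size p))) λ ls → lit (flips ls c) ≡ k
    switch-off-two c {k} eq with find-true c eq
    ... | x , cx with find-true (c ⊕ δ x) (suc-injective (trans (sym (count-unlight c cx)) eq))
    ... | y , cxy = linesThrough y ++ linesThrough x , suc-injective (suc-injective (begin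
      suc (suc (lit (flips (linesThrough y ++ linesThrough x) c)))
        ≡⟨ cong (λ n → suc (suc n)) (count-ext (flips-linesThrough-pair x y c)) ⟩
      suc (suc (count (c ⊕ δ x ⊕ δ y)))
        ≡⟨ cong suc (sym (count-unlight (c ⊕ δ x) cxy)) ⟩
      suc (count (c ⊕ δ x))
        ≡⟨ sym (count-unlight c cx) ⟩
      lit c
        ≡⟨ eq ⟩
      suc (suc k) ∎))

    reduce-to-0-or-1 : ∀ k c → lit c ≡ k →
             Σ (List (Fin (size p))) λ ls → lit (flips ls c) ≡ 0 ⊎ lit (flips ls c) ≡ 1
    reduce-to-0-or-1 zero          c eq = [] , inj₁ eq
    reduce-to-0-or-1 (suc zero)    c eq = [] , inj₂ eq
    reduce-to-0-or-1 (suc (suc k)) c eq with switch-off-two c eq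
    ... | ls , eq′ with reduce-to-0-or-1 k (flips ls c) eq′
    ... | ms , small rewrite sym (foldr-++ flip c ms ls) = ms ++ ls , small

    even-lit-clears : ∀ c → Even (lit c) → Σ (List (Fin (size p))) λ ls → lit (flips ls c) ≡ 0
    even-lit-clears c even with reduce-to-0-or-1 (lit c) c refl
    ... | ls , inj₁ none = ls , none
    ... | ls , inj₂ one  = contradiction parity-clash λ ()
      where
      parity-clash : parity 1 ≡ parity 0
      parity-clash = trans (cong parity (sym one)) (trans (parity-lit-flips ls c) (even⇒parity≡0ℙ even))

    odd-lit-to-one : ∀ c → Odd (lit c) → Σ (List (Fin (size p))) λ ls → lit (flips ls c) ≡ 1
    odd-lit-to-one c odd with reduce-to-0-or-1 (lit c) c refl
    ... | ls , inj₂ one  = ls , one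
    ... | ls , inj₁ none = contradiction parity-clash λ ()
      where
      parity-clash : parity 0 ≡ parity 1
      parity-clash = trans (cong parity (sym none)) (trans (parity-lit-flips ls c) (odd⇒parity≡1ℙ odd))

    irreducible⇒lit≤1 : ∀ c → Irreducible c → lit c ≤ 1
    irreducible⇒lit≤1 c irr with lit c in eq
    ... | zero        = z≤n
    ... | suc zero    = s≤s z≤n
    ... | suc (suc k) with switch-off-two c eq
    ...   | ls , fewer = ⊥-elim (irr (ls , subst (_< suc (suc k)) (sym fewer) (s≤s (n≤1+n k))))

    lit≡1⇒irreducible : ∀ c → lit c ≡ 1 → Irreducible c
    lit≡1⇒irreducible c one (ls , fewer) =
      contradiction parity-clash λ ()
      where
      none : lit (flips ls c) ≡ 0
      none = n<1⇒n≡0 (subst (lit (flips ls c) <_) one fewer)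
      parity-clash : parity 0 ≡ parity 1
      parity-clash = trans (cong parity (sym none)) (trans (parity-lit-flips ls c) (cong parity one))

theorem3 : (p : ℕ) → Odd p → (P : ProjectivePlane p) →
    ((c : Game.Config P) → Even (Game.lit P c) →
       Σ (List (Fin (size p))) λ ls → Game.lit P (Game.flips P ls c) ≡ 0)
    × ((c : Game.Config P) → Odd (Game.lit P c) →
       Σ (List (Fin (size p))) λ ls → Game.lit P (Game.flips P ls c) ≡ 1)
    × ((c : Game.Config P) → Game.Irreducible P c → Game.lit P c ≤ 1)
    × Σ (Game.Config P) (λ c → Game.Irreducible P c × Game.lit P c ≡ 1)
theorem3 p odd P =
  even-lit-clears P odd , odd-lit-to-one P odd , irreducible⇒lit≤1 P odd ,
  (δ point , lit≡1⇒irreducible P odd (δ point) (count-δ point) , count-δ point)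
  where
  point : Fin (size p)
  point = fromℕ< (m≤n+m 1 (p * p + p))
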